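{- Let $T$ be a topological space with the settling forcing relation $\Vdash$ (defined in the context). Let $U\subseteq T$ be a homogeneous open set, let $\phi$ be a formula all of whose parameters are ground model terms, and let $V\subseteq U$ be a non-empty open set with $V\Vdash\phi$. Then $U\Vdash\phi$.
   Context: Work in a classical ground model of set theory and let $T$ be a topological space. $T$ is locally homogeneous around $r,s\in T$ if there are open neighborhoods $J_r,J_s$ of $r,s$ respectively and a homeomorphism of $J_r$ onto $J_s$ sending $r$ to $s$. An open set $U$ is homogeneous if $T$ is locally homogeneous around all $r,s\in U$. Terms are defined recursively: a term is a set of the form $\{\langle\sigma_i,J_i\rangle : i\in I\}\cup\{\langle\sigma_h,r_h\rangle : h\in H\}$, where each $\sigma_i,\sigma_h$ is a term, each $J_i$ is an open subset of $T$, each $r_h$ is a point of $T$, and $I,H$ are index sets. For a set $x$, $\hat{x}=\{\langle\hat{y},T\rangle : y\in x\}$; terms of this form are ground model terms. For a term $\sigma$ and $r\in T$, define recursively $\sigma^r=\{\langle\sigma_i^r,T\rangle : \langle\sigma_i,J_i\rangle\in\sigma,\ J_i \text{ open},\ r\in J_i\}\cup\{\langle\sigma_h^r,T\rangle : \langle\sigma_h,r\rangle\in\sigma\}$. Formulas are first-order formulas in $\in,=,\wedge,\vee,\rightarrow,\exists,\forall$ with terms as parameters ($\neg\phi$ abbreviates $\phi\rightarrow\bot$, where $\bot$ is a formula forced only by $\emptyset$, e.g. $\hat 0\in\hat 0$); for a formula $\phi$ with parameters $\sigma_0,\dots,\sigma_k$, $\phi^r$ is the formula with each $\sigma_j$ replaced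 by $\sigma_j^r$. For $J$ open, $J\Vdash\phi$ is defined by recursion (for $=$ and $\in$ simultaneously by recursion on terms): $J\Vdash\sigma=\tau$ iff for all $\langle\sigma_i,J_i\rangle\in\sigma$ with $J_i$ open, $J\cap J_i\Vdash\sigma_i\in\tau$, and for all $\langle\tau_i,J_i\rangle\in\tau$ with $J_i$ open, $J\cap J_i\Vdash\tau_i\in\sigma$, and for all $r\in J$, $\sigma^r=\tau^r$ (as sets); $J\Vdash\sigma\in\tau$ iff for all $r\in J$ there are $\langle\tau_i,J_i\rangle\in\tau$ with $J_i$ open and an open $J_r\subseteq J_i$ containing $r$ with $J_r\Vdash\sigma=\tau_i$; $J\Vdash\phi\wedge\psi$ iff $J\Vdash\phi$ and $J\Vdash\psi$; $J\Vdash\phi\vee\psi$ iff for all $r\in J$ there is an open $J_r\subseteq J$ containing $r$ with $J_r\Vdash\phi$ or $J_r\Vdash\psi$; $J\Vdash\phi\rightarrow\psi$ iff for all open $J'\subseteq J$, $J'\Vdash\phi$ implies $J'\Vdash\psi$, and for all $r\in J$ there is an open $J_r\subseteq J$ containing $r$ such that for all open $K\subseteq J_r$, $K\Vdash\phi^r$ implies $K\Vdash\psi^r$; $J\Vdash\exists x\,\phi(x)$ iff for all $r\in J$ there are an open $J_r\subseteq J$ containing $r$ and a term $\sigma$ with $J_r\Vdash\phi(\sigma)$; $J\Vdash\forall x\,\phi(x)$ iff for all terms $\sigma$, $J\Vdash\phi(\sigma)$, and for all $r\in J$ there is an open $J_r\subseteq J$ containing $r$ such that for all terms $\sigma$, $J_r\Vdash\phi^r(\sigma)$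 (here $\sigma$ itself is not replaced by $\sigma^r$). -}

module Defs where

open import Data.Nat using (ℕ; suc)
open import Data.Fin using (Fin; zero; suc)
open import Data.Product using (Σ; _×_; _,_)
open import Data.Sum using (_⊎_; inj₁; inj₂)
open import Data.Empty using (⊥; ⊥-elim)
open import Data.Unit using (⊤)
open import Relation.Binary.PropositionalEquality using (_≡_)

record Space : Set₁ where
  field
    Carrier   : Set
    IsOpen    : (Carrier → Set) → Set
    open-resp : ∀ {P Q : Carrier → Set} →
                (∀ x → P x → Q x) → (∀ x → Q x → P x) → IsOpen P → IsOpen Q
    open-univ : IsOpen (λ _ → ⊤)
    open-∩    : ∀ {P Q : Carrier → Set} →
                IsOpen P → IsOpen Q → IsOpen (λ x → P x × Q x)
    open-⋃    : (I : Set) (P : I → Carrier → Set) →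
                (∀ i → IsOpen (P i)) → IsOpen (λ x → Σ I (λ i → P i x))

-- Ground model sets (Aczel's well-founded trees)

data V : Set₁ where
  sup : (A : Set) → (A → V) → V

-- All parameters are
-- represented as free variables (Fin n); a formula with parameters
-- σ₀ … σₖ is a pair of a formula and an environment assigning terms.

data Formula (n : ℕ) : Set where
  _∈ᶠ_ _≡ᶠ_      : Fin n → Fin n → Formula n
  _∧ᶠ_ _∨ᶠ_ _⇒ᶠ_ : Formula n → Formula n → Formula n
  ∃ᶠ ∀ᶠ          : Formula (suc n) → Formula n

module Forcing (𝒯 : Space) where
  open Space 𝒯 renaming (Carrier to T)

  record Open : Set₁ where
    constructor mkOpen
    field
      pt     : T → Set
      isOpen : IsOpen pt
  open Open public

  _∈ₒ_ : T → Open → Set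
  x ∈ₒ J = pt J x

  _⊆ₒ_ : Open → Open → Set
  J ⊆ₒ K = ∀ x → x ∈ₒ J → x ∈ₒ K

  _≈ₒ_ : Open → Open → Set
  J ≈ₒ K = J ⊆ₒ K × K ⊆ₒ J

  whole : Open
  whole = mkOpen (λ _ → ⊤) open-univ

  _∩_ : Open → Open → Open
  J ∩ K = mkOpen (λ x → x ∈ₒ J × x ∈ₒ K) (open-∩ (isOpen J) (isOpen K))

  NonEmpty : Open → Set
  NonEmpty J = Σ T (λ x → x ∈ₒ J)

  record Homeo (A B : Open) (r s : T) : Set₁ where
    field
      f      : (x : T) → x ∈ₒ A → T
      f∈     : ∀ x p → f x p ∈ₒ B
      g      : (y : T) → y ∈ₒ B → T
      g∈     : ∀ y q → g y q ∈ₒ A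
      gf     : ∀ x p q → g (f x p) q ≡ x
      fg     : ∀ y q p → f (g y q) p ≡ y
      f-cont : (W : Open) → IsOpen (λ x → Σ (x ∈ₒ A) (λ p → f x p ∈ₒ W))
      g-cont : (W : Open) → IsOpen (λ y → Σ (y ∈ₒ B) (λ q → g y q ∈ₒ W))
      f-r    : ∀ p → f r p ≡ s

  LocallyHomogeneous : T → T → Set₁
  LocallyHomogeneous r s =
    Σ Open (λ Jr → Σ Open (λ Js → r ∈ₒ Jr × s ∈ₒ Js × Homeo Jr Js r s))

  Homogeneous : Open → Set₁
  Homogeneous U = ∀ r s → r ∈ₒ U → s ∈ₒ U → LocallyHomogeneous r s

  -- Terms: {⟨σᵢ,Jᵢ⟩ : i ∈ I} ∪ {⟨σₕ,rₕ⟩ : h ∈ H}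

  data Term : Set₁ where
    term : (I : Set) → (I → Term) → (I → Open) →
           (H : Set) → (H → Term) → (H → T) → Term

  hat : V → Term
  hat (sup A x) = term A (λ a → hat (x a)) (λ _ → whole) ⊥ ⊥-elim ⊥-elim

  -- equality of terms as sets (extensional, pairs compared componentwise;
  -- pairs with an open second component and pairs with a point second
  -- component are kept apart)
  SetEq : Term → Term → Set
  SetEq (term I σ J H τ p) (term I' σ' J' H' τ' p') =
    (∀ i → Σ I' (λ i' → SetEq (σ i) (σ' i') × J i ≈ₒ J' i')) ×
    (∀ i' → Σ I (λ i → SetEq (σ i) (σ' i') × J i ≈ₒ J' i')) ×
    (∀ h → Σ H' (λ h' → SetEq (τ h) (τ' h') × p h ≡ p' h')) ×
    (∀ h' → Σ H (λ h → SetEq (τ h) (τ' h') × p h ≡ p' h'))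

  _^_ : Term → T → Term
  term I σ J H τ p ^ r =
    term (Σ I (λ i → r ∈ₒ J i) ⊎ Σ H (λ h → p h ≡ r)) ch (λ _ → whole)
         ⊥ ⊥-elim ⊥-elim
    where
    ch : Σ I (λ i → r ∈ₒ J i) ⊎ Σ H (λ h → p h ≡ r) → Term
    ch (inj₁ (i , _)) = σ i ^ r
    ch (inj₂ (h , _)) = τ h ^ r

  mutual
    _⊩_≐_ : Open → Term → Term → Set₁
    J ⊩ σ@(term I σs Js H σh ps) ≐ τ@(term I' τs Js' H' τh ps') =
      (∀ i → (J ∩ Js i) ⊩ σs i ∈' τ) ×
      (∀ i' → (J ∩ Js' i') ⊩ τs i' ∈' σ) ×
      (∀ r → r ∈ₒ J → SetEq (σ ^ r) (τ ^ r))

    _⊩_∈'_ : Open → Term → Term → Set₁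
    J ⊩ σ ∈' term I τs Js H τh ps =
      ∀ r → r ∈ₒ J →
        Σ I (λ i → Σ Open (λ K → K ⊆ₒ Js i × r ∈ₒ K × K ⊩ σ ≐ τs i))

  Env : ℕ → Set₁
  Env n = Fin n → Term

  _∷ₑ_ : ∀ {n} → Term → Env n → Env (suc n)
  (σ ∷ₑ ρ) zero    = σ
  (σ ∷ₑ ρ) (suc k) = ρ k

  _^ₑ_ : ∀ {n} → Env n → T → Env n
  (ρ ^ₑ r) k = ρ k ^ r

  _⊩_[_] : ∀ {n} → Open → Formula n → Env n → Set₁
  J ⊩ (x ∈ᶠ y) [ ρ ] = J ⊩ ρ x ∈' ρ y
  J ⊩ (x ≡ᶠ y) [ ρ ] = J ⊩ ρ x ≐ ρ y
  J ⊩ (φ ∧ᶠ ψ) [ ρ ] = (J ⊩ φ [ ρ ]) × (J ⊩ ψ [ ρ ])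
  J ⊩ (φ ∨ᶠ ψ) [ ρ ] =
    ∀ r → r ∈ₒ J → Σ Open (λ K → K ⊆ₒ J × r ∈ₒ K ×
                                 ((K ⊩ φ [ ρ ]) ⊎ (K ⊩ ψ [ ρ ])))
  J ⊩ (φ ⇒ᶠ ψ) [ ρ ] =
    (∀ J' → J' ⊆ₒ J → J' ⊩ φ [ ρ ] → J' ⊩ ψ [ ρ ]) ×
    (∀ r → r ∈ₒ J → Σ Open (λ K → K ⊆ₒ J × r ∈ₒ K ×
         (∀ K' → K' ⊆ₒ K → K' ⊩ φ [ ρ ^ₑ r ] → K' ⊩ ψ [ ρ ^ₑ r ])))
  J ⊩ ∃ᶠ φ [ ρ ] =
    ∀ r → r ∈ₒ J → Σ Open (λ K → K ⊆ₒ J × r ∈ₒ K ×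
                                 Σ Term (λ σ → K ⊩ φ [ σ ∷ₑ ρ ]))
  J ⊩ ∀ᶠ φ [ ρ ] =
    (∀ σ → J ⊩ φ [ σ ∷ₑ ρ ]) ×
    (∀ r → r ∈ₒ J → Σ Open (λ K → K ⊆ₒ J × r ∈ₒ K ×
                                 (∀ σ → K ⊩ φ [ σ ∷ₑ (ρ ^ₑ r) ])))

-- A homeomorphism h of open subspaces A ≅ B acts on terms (by moving open sets and points) and
-- preserves forcing: K ⊩ φ[ρ] gives h[K] ⊩ φ[h ρ].  Ground model terms mention only the whole
-- space and no points, so h fixes them.  Given V ⊩ φ with w ∈ V, each r ∈ U has a local
-- homeomorphism sending w to r, so some neighbourhood of r forces φ; since forcing is local,
-- U ⊩ φ.
module Submission where

open import Defs
open import Data.Nat using (ℕ)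
open import Data.Fin using (Fin; zero; suc)
open import Data.Product using (Σ; _×_; _,_; proj₁; proj₂)
open import Data.Sum using (_⊎_; inj₁; inj₂)
open import Data.Empty using (⊥; ⊥-elim)
open import Data.Unit using (tt)
open import Relation.Binary.PropositionalEquality using (_≡_; refl; sym; trans; subst)

module Homogeneity (𝒯 : Space) where
  open Space 𝒯 renaming (Carrier to T)
  open Forcing 𝒯

  record _≅_ (A B : Open) : Set₁ where
    field
      to        : (x : T) → x ∈ₒ A → T
      to∈       : ∀ x a → to x a ∈ₒ B
      from      : (y : T) → y ∈ₒ B → T
      from∈     : ∀ y b → from y b ∈ₒ A
      from∘to   : ∀ x a b → from (to x a) b ≡ x
      to∘from   : ∀ y b a → to (from y b) a ≡ y
      to-cont   : (W : Open) → IsOpen (λ x → Σ (x ∈ₒ A) (λ a → to x a ∈ₒ W))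
      from-cont : (W : Open) → IsOpen (λ y → Σ (y ∈ₒ B) (λ b → from y b ∈ₒ W))
  open _≅_

  ≅-sym : ∀ {A B} → A ≅ B → B ≅ A
  ≅-sym h = record
    { to = from h ; to∈ = from∈ h ; from = to h ; from∈ = to∈ h
    ; from∘to = to∘from h ; to∘from = from∘to h
    ; to-cont = from-cont h ; from-cont = to-cont h }

  Homeo⇒≅ : ∀ {A B r s} → Homeo A B r s → A ≅ B
  Homeo⇒≅ H = record
    { to = Homeo.f H ; to∈ = Homeo.f∈ H ; from = Homeo.g H ; from∈ = Homeo.g∈ H
    ; from∘to = Homeo.gf H ; to∘from = Homeo.fg H
    ; to-cont = Homeo.f-cont H ; from-cont = Homeo.g-cont H }

  module _ {A B : Open} (h : A ≅ B) where

    to-subst : ∀ {z x} (e : z ≡ x) (a : x ∈ₒ A) →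
               to h x a ≡ to h z (subst (_∈ₒ A) (sym e) a)
    to-subst refl a = refl

    -- Membership proofs may differ, but to h x a = to h (from h (to h x a')) _ = to h x a'.
    to-irrelevant : ∀ {x} (a a' : x ∈ₒ A) → to h x a ≡ to h x a'
    to-irrelevant {x} a a' =
      trans (to-subst (from∘to h x a' (to∈ h x a')) a) (to∘from h (to h x a') (to∈ h x a') _)

    to-cong : ∀ {x x'} → x ≡ x' → (a : x ∈ₒ A) (a' : x' ∈ₒ A) → to h x a ≡ to h x' a'
    to-cong refl = to-irrelevant

  from-cong : ∀ {A B} (h : A ≅ B) {y y'} → y ≡ y' →
              (b : y ∈ₒ B) (b' : y' ∈ₒ B) → from h y b ≡ from h y' b'
  from-cong h = to-cong (≅-sym h)

  to≡⇒from≡ : ∀ {A B} (h : A ≅ B) {x y} (a : x ∈ₒ A) (b : y ∈ₒ B) →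
              to h x a ≡ y → from h y b ≡ x
  to≡⇒from≡ h {x} a b e = trans (from-cong h (sym e) b (to∈ h x a)) (from∘to h x a (to∈ h x a))

  -- h[K ∩ A], presented as the preimage of K under h⁻¹ so that openness is free.
  image : ∀ {A B} → A ≅ B → Open → Open
  image {B = B} h K = mkOpen (λ y → Σ (y ∈ₒ B) (λ b → from h y b ∈ₒ K)) (from-cont h K)

  image-mono : ∀ {A B} (h : A ≅ B) K K' → K ⊆ₒ K' → image h K ⊆ₒ image h K'
  image-mono h K K' K⊆K' y (b , k) = b , K⊆K' _ k

  image-sym-⊆ : ∀ {A B} (h : A ≅ B) J K → J ⊆ₒ image h K → image (≅-sym h) J ⊆ₒ K
  image-sym-⊆ h J K J⊆hK x (a , j) =
    let (b , k) = J⊆hK _ j in subst (_∈ₒ K) (from∘to h x a b) k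

  ⊆-image-image-sym : ∀ {A B} (h : A ≅ B) J K →
                      J ⊆ₒ image h K → J ⊆ₒ image h (image (≅-sym h) J)
  ⊆-image-image-sym h J K J⊆hK y j =
    let b = proj₁ (J⊆hK y j) in
    b , from∈ h y b , subst (_∈ₒ J) (sym (to∘from h y b (from∈ h y b))) j

  image-∈ : ∀ {A B} (h : A ≅ B) {K x} (a : x ∈ₒ A) → x ∈ₒ K → to h x a ∈ₒ image h K
  image-∈ h {K} {x} a k = to∈ h x a , subst (_∈ₒ K) (sym (from∘to h x a (to∈ h x a))) k

  Index : Term → Set
  Index (term I _ _ _ _ _) = I

  child : (σ : Term) → Index σ → Term
  child (term _ σs _ _ _ _) = σs

  Transportsₒ : ∀ {A B} → A ≅ B → Open → Open → Set
  Transportsₒ {A} {B} h U U' = (∀ x (a : x ∈ₒ A) → x ∈ₒ U → to h x a ∈ₒ U') ×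
                               (∀ y (b : y ∈ₒ B) → y ∈ₒ U' → from h y b ∈ₒ U)

  Transports : ∀ {A B} → A ≅ B → Term → Term → Set
  Transports {A} {B} h (term I σs Js H τs ps) (term I' σs' Js' H' τs' ps') =
    (∀ i → Σ I' (λ i' → Transports h (σs i) (σs' i') × Transportsₒ h (Js i) (Js' i'))) ×
    (∀ i' → Σ I (λ i → Transports h (σs i) (σs' i') × Transportsₒ h (Js i) (Js' i'))) ×
    (∀ k (a : ps k ∈ₒ A) → Σ H' (λ k' → Transports h (τs k) (τs' k') × to h (ps k) a ≡ ps' k')) ×
    (∀ k' (b : ps' k' ∈ₒ B) → Σ H (λ k → Transports h (τs k) (τs' k') × from h (ps' k') b ≡ ps k))

  Transportsₑ : ∀ {A B} → A ≅ B → ∀ {n} → Env n → Env n → Set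
  Transportsₑ h {n} ρ ρ' = (k : Fin n) → Transports h (ρ k) (ρ' k)

  Transports-sym : ∀ {A B} (h : A ≅ B) σ σ' → Transports h σ σ' → Transports (≅-sym h) σ' σ
  Transports-sym h (term _ _ _ _ _ _) (term _ _ _ _ _ _) (c₁ , c₂ , c₃ , c₄) =
    (λ i' → let (i , R , o₁ , o₂) = c₂ i' in i , Transports-sym h _ _ R , o₂ , o₁) ,
    (λ i → let (i' , R , o₁ , o₂) = c₁ i in i' , Transports-sym h _ _ R , o₂ , o₁) ,
    (λ k' b → let (k , R , e) = c₄ k' b in k , Transports-sym h _ _ R , e) ,
    (λ k a → let (k' , R , e) = c₃ k a in k' , Transports-sym h _ _ R , e)

  Transportsₑ-sym : ∀ {A B} (h : A ≅ B) {n} {ρ ρ' : Env n} →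
                    Transportsₑ h ρ ρ' → Transportsₑ (≅-sym h) ρ' ρ
  Transportsₑ-sym h R k = Transports-sym h _ _ (R k)

  ∷-Transportsₑ : ∀ {A B} (h : A ≅ B) {n} {σ σ'} {ρ ρ' : Env n} →
                  Transports h σ σ' → Transportsₑ h ρ ρ' → Transportsₑ h (σ ∷ₑ ρ) (σ' ∷ₑ ρ')
  ∷-Transportsₑ h R Rs zero    = R
  ∷-Transportsₑ h R Rs (suc k) = Rs k

  -- Pairs with a point outside A are dropped.
  transport : ∀ {A B} → A ≅ B → Term → Term
  transport {A} h (term I σs Js H τs ps) =
    term I (λ i → transport h (σs i)) (λ i → image h (Js i))
         (Σ H (λ k → ps k ∈ₒ A)) (λ (k , _) → transport h (τs k)) (λ (k , a) → to h (ps k) a)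

  Transports-transport : ∀ {A B} (h : A ≅ B) σ → Transports h σ (transport h σ)
  Transports-transport h (term I σs Js H τs ps) =
    (λ i → i , Transports-transport h (σs i) , open-image i) ,
    (λ i → i , Transports-transport h (σs i) , open-image i) ,
    (λ k a → (k , a) , Transports-transport h (τs k) , refl) ,
    (λ (k , a) b → k , Transports-transport h (τs k) , from∘to h (ps k) a b)
    where
    open-image : ∀ i → Transportsₒ h (Js i) (image h (Js i))
    open-image i = (λ x a → image-∈ h {Js i} a) ,
                   (λ y b (b' , k) → subst (_∈ₒ Js i) (from-cong h refl b' b) k)

  Transportsₒ-whole : ∀ {A B} (h : A ≅ B) → Transportsₒ h whole whole
  Transportsₒ-whole h = (λ _ _ _ → tt) , (λ _ _ _ → tt)

  Transports-hat : ∀ {A B} (h : A ≅ B) x → Transports h (hat x) (hat x)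
  Transports-hat h (sup X x) =
    (λ a → a , Transports-hat h (x a) , Transportsₒ-whole h) ,
    (λ a → a , Transports-hat h (x a) , Transportsₒ-whole h) ,
    (λ ()) , (λ ())

  Transports-^ : ∀ {A B} (h : A ≅ B) σ σ' {r} (a : r ∈ₒ A) →
                 Transports h σ σ' → Transports h (σ ^ r) (σ' ^ to h r a)
  Transports-^ {A} {B} h σ@(term I σs Js H τs ps) σ'@(term I' σs' Js' H' τs' ps') {r} a
               (c₁ , c₂ , c₃ , c₄) = forth , back , (λ ()) , (λ ())
    where
    forth : (j : Index (σ ^ r)) → Σ (Index (σ' ^ to h r a)) λ j' →
              Transports h (child (σ ^ r) j) (child (σ' ^ to h r a) j') × Transportsₒ h whole whole
    forth (inj₁ (i , r∈J)) =
      let (i' , R , (o₁ , _)) = c₁ i in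
      inj₁ (i' , o₁ r a r∈J) , Transports-^ h _ _ a R , Transportsₒ-whole h
    forth (inj₂ (k , pk≡r)) =
      let a' = subst (_∈ₒ A) (sym pk≡r) a
          (k' , R , e) = c₃ k a' in
      inj₂ (k' , trans (sym e) (to-cong h pk≡r a' a)) , Transports-^ h _ _ a R , Transportsₒ-whole h
    back : (j' : Index (σ' ^ to h r a)) → Σ (Index (σ ^ r)) λ j →
             Transports h (child (σ ^ r) j) (child (σ' ^ to h r a) j') × Transportsₒ h whole whole
    back (inj₁ (i' , hr∈J')) =
      let (i , R , (_ , o₂)) = c₂ i' in
      inj₁ (i , subst (_∈ₒ Js i) (from∘to h r a (to∈ h r a)) (o₂ _ (to∈ h r a) hr∈J')) ,
      Transports-^ h _ _ a R , Transportsₒ-whole h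
    back (inj₂ (k' , pk'≡hr)) =
      let b = subst (_∈ₒ B) (sym pk'≡hr) (to∈ h r a)
          (k , R , e) = c₄ k' b in
      inj₂ (k , trans (sym e) (to≡⇒from≡ h a b (sym pk'≡hr))) ,
      Transports-^ h _ _ a R , Transportsₒ-whole h

  -- The shape of every σ ^ r: whole-space labels only and no point-labelled pairs.
  Pure : Term → Set
  Pure (term I σs Js H _ _) = (∀ i → Pure (σs i) × whole ⊆ₒ Js i) × (H → ⊥)

  ^-Pure : ∀ σ r → Pure (σ ^ r)
  ^-Pure (term I σs Js H τs ps) r = children , (λ ())
    where
    children : (j : Index (term I σs Js H τs ps ^ r)) →
               Pure (child (term I σs Js H τs ps ^ r) j) × whole ⊆ₒ whole
    children (inj₁ (i , _)) = ^-Pure (σs i) r , (λ _ _ → tt)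
    children (inj₂ (k , _)) = ^-Pure (τs k) r , (λ _ _ → tt)

  Transports-Pure⇒SetEq : ∀ {A B} (h : A ≅ B) σ σ' → Pure σ → Pure σ' →
                          Transports h σ σ' → SetEq σ σ'
  Transports-Pure⇒SetEq h (term _ _ Js _ _ _) (term _ _ Js' _ _ _) (P , noH) (P' , noH')
                        (c₁ , c₂ , _ , _) =
    (λ i → let (i' , R , _) = c₁ i in i' , pair (Js i) (Js' i') R (P i) (P' i')) ,
    (λ i' → let (i , R , _) = c₂ i' in i , pair (Js i) (Js' i') R (P i) (P' i')) ,
    (λ k → ⊥-elim (noH k)) , (λ k' → ⊥-elim (noH' k'))
    where
    pair : ∀ {σ σ'} J J' → Transports h σ σ' →
           Pure σ × whole ⊆ₒ J → Pure σ' × whole ⊆ₒ J' → SetEq σ σ' × J ≈ₒ J'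
    pair J J' R (p , wJ) (p' , wJ') =
      Transports-Pure⇒SetEq h _ _ p p' R , (λ x _ → wJ' x tt) , (λ x _ → wJ x tt)

  SetEq-sym : ∀ σ τ → SetEq σ τ → SetEq τ σ
  SetEq-sym (term _ _ _ _ _ _) (term _ _ _ _ _ _) (c₁ , c₂ , c₃ , c₄) =
    (λ i' → let (i , R , J⊆ , ⊇J) = c₂ i' in i , SetEq-sym _ _ R , ⊇J , J⊆) ,
    (λ i → let (i' , R , J⊆ , ⊇J) = c₁ i in i' , SetEq-sym _ _ R , ⊇J , J⊆) ,
    (λ k' → let (k , R , e) = c₄ k' in k , SetEq-sym _ _ R , sym e) ,
    (λ k → let (k' , R , e) = c₃ k in k' , SetEq-sym _ _ R , sym e)

  SetEq-trans : ∀ σ τ υ → SetEq σ τ → SetEq τ υ → SetEq σ υ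
  SetEq-trans (term _ _ _ _ _ _) (term _ _ _ _ _ _) (term _ _ _ _ _ _)
              (a₁ , a₂ , a₃ , a₄) (b₁ , b₂ , b₃ , b₄) =
    (λ i → let (j , R , o₁ , o₂) = a₁ i ; (k , R' , o₁' , o₂') = b₁ j in
           k , SetEq-trans _ _ _ R R' , (λ x y → o₁' x (o₁ x y)) , (λ x y → o₂ x (o₂' x y))) ,
    (λ k → let (j , R' , o₁' , o₂') = b₂ k ; (i , R , o₁ , o₂) = a₂ j in
           i , SetEq-trans _ _ _ R R' , (λ x y → o₁' x (o₁ x y)) , (λ x y → o₂ x (o₂' x y))) ,
    (λ i → let (j , R , e) = a₃ i ; (k , R' , e') = b₃ j in k , SetEq-trans _ _ _ R R' , trans e e') ,
    (λ k → let (j , R' , e') = b₄ k ; (i , R , e) = a₄ j in i , SetEq-trans _ _ _ R R' , trans e e')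

  Transports⇒SetEq-^ : ∀ {A B} (h : A ≅ B) σ σ' → Transports h σ σ' →
                       ∀ {y} (b : y ∈ₒ B) → SetEq (σ ^ from h y b) (σ' ^ y)
  Transports⇒SetEq-^ h σ σ' R {y} b =
    SetEq-sym (σ' ^ y) (σ ^ from h y b)
      (Transports-Pure⇒SetEq (≅-sym h) _ _ (^-Pure σ' y) (^-Pure σ (from h y b))
        (Transports-^ (≅-sym h) σ' σ b (Transports-sym h σ σ' R)))

  Transportsₑ-^ : ∀ {A B} (h : A ≅ B) {n} {ρ ρ' : Env n} → Transportsₑ h ρ ρ' →
                  ∀ {y} (b : y ∈ₒ B) → Transportsₑ h (ρ ^ₑ from h y b) (ρ' ^ₑ y)
  Transportsₑ-^ h R b k =
    Transports-sym (≅-sym h) _ _ (Transports-^ (≅-sym h) _ _ b (Transports-sym h _ _ (R k)))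

  ⊩∈-restrict : ∀ σ τ {J J'} → J' ⊆ₒ J → J ⊩ σ ∈' τ → J' ⊩ σ ∈' τ
  ⊩∈-restrict σ (term _ _ _ _ _ _) J'⊆J F r r∈J' = F r (J'⊆J r r∈J')

  ⊩≐-restrict : ∀ σ τ {J J'} → J' ⊆ₒ J → J ⊩ σ ≐ τ → J' ⊩ σ ≐ τ
  ⊩≐-restrict σ@(term _ σs Js _ _ _) τ@(term _ τs Ks _ _ _) {J} {J'} J'⊆J (F₁ , F₂ , F₃) =
    (λ i → ⊩∈-restrict (σs i) τ {J ∩ Js i} {J' ∩ Js i} (λ x (j , k) → J'⊆J x j , k) (F₁ i)) ,
    (λ i → ⊩∈-restrict (τs i) σ {J ∩ Ks i} {J' ∩ Ks i} (λ x (j , k) → J'⊆J x j , k) (F₂ i)) ,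
    (λ r r∈J' → F₃ r (J'⊆J r r∈J'))

  ⊩-restrict : ∀ {n} (φ : Formula n) {ρ : Env n} {J J'} →
               J' ⊆ₒ J → J ⊩ φ [ ρ ] → J' ⊩ φ [ ρ ]
  ⊩-restrict (x ∈ᶠ y) {ρ} J'⊆J F = ⊩∈-restrict (ρ x) (ρ y) J'⊆J F
  ⊩-restrict (x ≡ᶠ y) {ρ} J'⊆J F = ⊩≐-restrict (ρ x) (ρ y) J'⊆J F
  ⊩-restrict (φ ∧ᶠ ψ) J'⊆J (F , G) = ⊩-restrict φ J'⊆J F , ⊩-restrict ψ J'⊆J G
  ⊩-restrict (φ ∨ᶠ ψ) {ρ} {J' = J'} J'⊆J F r r∈J' =
    let (K , _ , r∈K , G) = F r (J'⊆J r r∈J') in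
    (K ∩ J') , (λ _ → proj₂) , (r∈K , r∈J') , restrict-⊎ G
    where
    restrict-⊎ : ∀ {K} → (K ⊩ φ [ ρ ]) ⊎ (K ⊩ ψ [ ρ ]) →
                 ((K ∩ J') ⊩ φ [ ρ ]) ⊎ ((K ∩ J') ⊩ ψ [ ρ ])
    restrict-⊎ (inj₁ F) = inj₁ (⊩-restrict φ (λ _ → proj₁) F)
    restrict-⊎ (inj₂ G) = inj₂ (⊩-restrict ψ (λ _ → proj₁) G)
  ⊩-restrict (φ ⇒ᶠ ψ) {J' = J'} J'⊆J (F₁ , F₂) =
    (λ J'' J''⊆J' → F₁ J'' (λ x k → J'⊆J x (J''⊆J' x k))) ,
    (λ r r∈J' → let (K , _ , r∈K , G) = F₂ r (J'⊆J r r∈J') in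
       (K ∩ J') , (λ _ → proj₂) , (r∈K , r∈J') ,
       (λ K' K'⊆K∩J' → G K' (λ x k → proj₁ (K'⊆K∩J' x k))))
  ⊩-restrict (∃ᶠ φ) {J' = J'} J'⊆J F r r∈J' =
    let (K , _ , r∈K , σ , G) = F r (J'⊆J r r∈J') in
    (K ∩ J') , (λ _ → proj₂) , (r∈K , r∈J') , σ , ⊩-restrict φ (λ _ → proj₁) G
  ⊩-restrict (∀ᶠ φ) {J' = J'} J'⊆J (F₁ , F₂) =
    (λ σ → ⊩-restrict φ J'⊆J (F₁ σ)) ,
    (λ r r∈J' → let (K , _ , r∈K , G) = F₂ r (J'⊆J r r∈J') in
       (K ∩ J') , (λ _ → proj₂) , (r∈K , r∈J') , (λ σ → ⊩-restrict φ (λ _ → proj₁) (G σ)))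

  LocallyForces : ∀ {n} → Open → Formula n → Env n → Set₁
  LocallyForces J φ ρ = ∀ r → r ∈ₒ J → Σ Open (λ K → K ⊆ₒ J × r ∈ₒ K × K ⊩ φ [ ρ ])

  ⊩-glue : ∀ {n} (φ : Formula n) {ρ : Env n} {J} → LocallyForces J φ ρ → J ⊩ φ [ ρ ]
  ⊩-glue (x ∈ᶠ y) {ρ} L with ρ y
  ... | term _ _ _ _ _ _ = λ r r∈J → let (_ , _ , r∈K , F) = L r r∈J in F r r∈K
  ⊩-glue (x ≡ᶠ y) {ρ} L with ρ x | ρ y
  ... | term _ _ _ _ _ _ | term _ _ _ _ _ _ =
    (λ i r (r∈J , r∈Ji) → let (_ , _ , r∈K , F , _ , _) = L r r∈J in F i r (r∈K , r∈Ji)) ,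
    (λ i r (r∈J , r∈Ji) → let (_ , _ , r∈K , _ , F , _) = L r r∈J in F i r (r∈K , r∈Ji)) ,
    (λ r r∈J → let (_ , _ , r∈K , _ , _ , F) = L r r∈J in F r r∈K)
  ⊩-glue (φ ∧ᶠ ψ) L =
    ⊩-glue φ (λ r r∈J → let (K , K⊆J , r∈K , F , _) = L r r∈J in K , K⊆J , r∈K , F) ,
    ⊩-glue ψ (λ r r∈J → let (K , K⊆J , r∈K , _ , G) = L r r∈J in K , K⊆J , r∈K , G)
  ⊩-glue (φ ∨ᶠ ψ) L r r∈J =
    let (K , K⊆J , r∈K , F) = L r r∈J ; (K' , K'⊆K , r∈K' , G) = F r r∈K in
    K' , (λ x k → K⊆J x (K'⊆K x k)) , r∈K' , G
  ⊩-glue (φ ⇒ᶠ ψ) L =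
    (λ J' J'⊆J G → ⊩-glue ψ (λ r r∈J' →
       let (K , _ , r∈K , F , _) = L r (J'⊆J r r∈J') in
       (K ∩ J') , (λ _ → proj₂) , (r∈K , r∈J') ,
       F (K ∩ J') (λ _ → proj₁) (⊩-restrict φ (λ _ → proj₂) G))) ,
    (λ r r∈J → let (K , K⊆J , r∈K , _ , F) = L r r∈J ; (K' , K'⊆K , r∈K' , G) = F r r∈K in
       K' , (λ x k → K⊆J x (K'⊆K x k)) , r∈K' , G)
  ⊩-glue (∃ᶠ φ) L r r∈J =
    let (K , K⊆J , r∈K , F) = L r r∈J ; (K' , K'⊆K , r∈K' , G) = F r r∈K in
    K' , (λ x k → K⊆J x (K'⊆K x k)) , r∈K' , G
  ⊩-glue (∀ᶠ φ) L =
    (λ σ → ⊩-glue φ (λ r r∈J → let (K , K⊆J , r∈K , F , _) = L r r∈J in K , K⊆J , r∈K , F σ)) ,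
    (λ r r∈J → let (K , K⊆J , r∈K , _ , F) = L r r∈J ; (K' , K'⊆K , r∈K' , G) = F r r∈K in
       K' , (λ x k → K⊆J x (K'⊆K x k)) , r∈K' , G)

  image-⊆ : ∀ {A B} (h : A ≅ B) {U U'} K → Transportsₒ h U U' → K ⊆ₒ U → image h K ⊆ₒ U'
  image-⊆ h {U' = U'} K (forth , _) K⊆U y (b , k) =
    subst (_∈ₒ U') (to∘from h y b (from∈ h y b)) (forth _ (from∈ h y b) (K⊆U _ k))

  image-∩ : ∀ {A B} (h : A ≅ B) {U U'} K → Transportsₒ h U U' →
            (image h K ∩ U') ⊆ₒ image h (K ∩ U)
  image-∩ h K (_ , back) y ((b , k) , u') = b , k , back y b u'

  mutual
    ⊩∈-transport : ∀ {A B} (h : A ≅ B) σ σ' τ τ' → Transports h σ σ' → Transports h τ τ' →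
                   ∀ K → K ⊩ σ ∈' τ → image h K ⊩ σ' ∈' τ'
    ⊩∈-transport h σ σ' (term _ τs Js _ _ _) (term _ τs' Js' _ _ _) Rσ (c₁ , _) K F r' (b , m) =
      let (i , K₁ , K₁⊆Ji , r∈K₁ , F₁) = F (from h r' b) m
          (i' , R , Ji~Ji') = c₁ i
      in i' , image h K₁ , image-⊆ h {Js i} {Js' i'} K₁ Ji~Ji' K₁⊆Ji , (b , r∈K₁) ,
         ⊩≐-transport h σ σ' (τs i) (τs' i') Rσ R K₁ F₁

    ⊩≐-transport : ∀ {A B} (h : A ≅ B) σ σ' τ τ' → Transports h σ σ' → Transports h τ τ' →
                   ∀ K → K ⊩ σ ≐ τ → image h K ⊩ σ' ≐ τ'
    ⊩≐-transport h σ@(term _ σs Js _ _ _) σ'@(term _ σs' Js' _ _ _)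
                   τ@(term _ τs Ks _ _ _) τ'@(term _ τs' Ks' _ _ _) Rσ Rτ K (F₁ , F₂ , F₃) =
      (λ i' → let (i , R , Ji~Ji') = proj₁ (proj₂ Rσ) i' in
         ⊩∈-restrict (σs' i') τ' {image h (K ∩ Js i)} {image h K ∩ Js' i'}
           (image-∩ h {Js i} {Js' i'} K Ji~Ji')
           (⊩∈-transport h (σs i) (σs' i') τ τ' R Rτ (K ∩ Js i) (F₁ i))) ,
      (λ i' → let (i , R , Ki~Ki') = proj₁ (proj₂ Rτ) i' in
         ⊩∈-restrict (τs' i') σ' {image h (K ∩ Ks i)} {image h K ∩ Ks' i'}
           (image-∩ h {Ks i} {Ks' i'} K Ki~Ki')
           (⊩∈-transport h (τs i) (τs' i') σ σ' R Rσ (K ∩ Ks i) (F₂ i))) ,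
      (λ r' (b , m) → let r = from h r' b in
         SetEq-trans (σ' ^ r') (σ ^ r) (τ' ^ r')
           (SetEq-sym (σ ^ r) (σ' ^ r') (Transports⇒SetEq-^ h σ σ' Rσ b))
           (SetEq-trans (σ ^ r) (τ ^ r) (τ' ^ r') (F₃ r m) (Transports⇒SetEq-^ h τ τ' Rτ b)))

  ⊩-transport : ∀ {A B} (h : A ≅ B) {n} (φ : Formula n) {ρ ρ' : Env n} → Transportsₑ h ρ ρ' →
                ∀ K → K ⊩ φ [ ρ ] → image h K ⊩ φ [ ρ' ]
  ⊩-transport h (x ∈ᶠ y) {ρ} {ρ'} R K F = ⊩∈-transport h (ρ x) (ρ' x) (ρ y) (ρ' y) (R x) (R y) K F
  ⊩-transport h (x ≡ᶠ y) {ρ} {ρ'} R K F = ⊩≐-transport h (ρ x) (ρ' x) (ρ y) (ρ' y) (R x) (R y) K F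
  ⊩-transport h (φ ∧ᶠ ψ) R K (F , G) = ⊩-transport h φ R K F , ⊩-transport h ψ R K G
  ⊩-transport h (φ ∨ᶠ ψ) {ρ} {ρ'} R K F r' (b , m) =
    let (K₁ , K₁⊆K , r∈K₁ , G) = F (from h r' b) m in
    image h K₁ , image-mono h K₁ K K₁⊆K , (b , r∈K₁) , transport-⊎ G
    where
    transport-⊎ : ∀ {K₁} → (K₁ ⊩ φ [ ρ ]) ⊎ (K₁ ⊩ ψ [ ρ ]) →
                  (image h K₁ ⊩ φ [ ρ' ]) ⊎ (image h K₁ ⊩ ψ [ ρ' ])
    transport-⊎ (inj₁ F) = inj₁ (⊩-transport h φ R _ F)
    transport-⊎ (inj₂ G) = inj₂ (⊩-transport h ψ R _ G)
  ⊩-transport h (φ ⇒ᶠ ψ) {ρ} {ρ'} R K (F₁ , F₂) =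
    transport-⇒ R K F₁ ,
    (λ r' (b , m) → let (K₁ , K₁⊆K , r∈K₁ , G) = F₂ (from h r' b) m in
       image h K₁ , image-mono h K₁ K K₁⊆K , (b , r∈K₁) , transport-⇒ (Transportsₑ-^ h R b) K₁ G)
    where
    -- An open J' ⊆ h[K₁] is the image of its preimage h⁻¹[J'] ⊆ K₁.
    transport-⇒ : ∀ {ϱ ϱ'} → Transportsₑ h ϱ ϱ' → ∀ K₁ →
                  (∀ K' → K' ⊆ₒ K₁ → K' ⊩ φ [ ϱ ] → K' ⊩ ψ [ ϱ ]) →
                  (∀ J' → J' ⊆ₒ image h K₁ → J' ⊩ φ [ ϱ' ] → J' ⊩ ψ [ ϱ' ])
    transport-⇒ Rϱ K₁ G J' J'⊆hK₁ J'⊩φ =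
      ⊩-restrict ψ (⊆-image-image-sym h J' K₁ J'⊆hK₁)
        (⊩-transport h ψ Rϱ _
          (G (image (≅-sym h) J') (image-sym-⊆ h J' K₁ J'⊆hK₁)
             (⊩-transport (≅-sym h) φ (Transportsₑ-sym h Rϱ) J' J'⊩φ)))
  ⊩-transport h (∃ᶠ φ) R K F r' (b , m) =
    let (K₁ , K₁⊆K , r∈K₁ , σ , G) = F (from h r' b) m in
    image h K₁ , image-mono h K₁ K K₁⊆K , (b , r∈K₁) ,
    transport h σ , ⊩-transport h φ (∷-Transportsₑ h (Transports-transport h σ) R) K₁ G
  ⊩-transport h (∀ᶠ φ) R K (F₁ , F₂) =
    (λ σ' → ⊩-transport h φ (∷-Transportsₑ h (preimage σ') R) K (F₁ (transport (≅-sym h) σ'))) ,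
    (λ r' (b , m) → let (K₁ , K₁⊆K , r∈K₁ , G) = F₂ (from h r' b) m in
       image h K₁ , image-mono h K₁ K K₁⊆K , (b , r∈K₁) ,
       (λ σ' → ⊩-transport h φ (∷-Transportsₑ h (preimage σ') (Transportsₑ-^ h R b)) K₁
                 (G (transport (≅-sym h) σ'))))
    where
    preimage : ∀ σ' → Transports h (transport (≅-sym h) σ') σ'
    preimage σ' = Transports-sym (≅-sym h) _ _ (Transports-transport (≅-sym h) σ')

mainTheorem5 : (𝒯 : Space) → let open Forcing 𝒯 in
    (U W : Open) → Homogeneous U → W ⊆ₒ U → NonEmpty W →
    (n : ℕ) (φ : Formula n) (x : Fin n → V) →
    W ⊩ φ [ (λ k → hat (x k)) ] → U ⊩ φ [ (λ k → hat (x k)) ]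
mainTheorem5 𝒯 U W homogeneous W⊆U (w , w∈W) n φ x W⊩φ = ⊩-glue φ λ r r∈U →
  let (_ , _ , w∈Jw , r∈Jr , H) = homogeneous w r (W⊆U w w∈W) r∈U
      h = Homeo⇒≅ H
      hW⊩φ = ⊩-transport h φ (λ k → Transports-hat h (x k)) W W⊩φ
      h⁻¹r≡w = to≡⇒from≡ h w∈Jw r∈Jr (Homeo.f-r H w∈Jw)
      r∈hW = r∈Jr , subst (_∈ₒ W) (sym h⁻¹r≡w) w∈W
  in (image h W ∩ U) , (λ _ → proj₂) , (r∈hW , r∈U) , ⊩-restrict φ (λ _ → proj₁) hW⊩φ
  where open Forcing 𝒯
        open Homogeneity 𝒯
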